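{- Let $T \in \mathcal{T}_p$ be a plane binary tree with $p$ internal nodes. Define $f_{\mathrm{Tree}}^T$ to be the sum, over all sequences $\emptyset = T_0, T_1, \dots, T_p = T$ with $T_j = \mathrm{SG}(T_{j-1}, i_j)$ for some $i_j \in \{0,\dots,j-1\}$, of $q^{\,i_1 + \cdots + i_p}$; and define $f_{\mathrm{Tree}'}^T$ to be the number of sequences $\emptyset = T_0, T_1,\dots,T_p = T$ with $T_{j-1} = T_j^*$ for all $j$. Then $$f_{\mathrm{Tree}}^T = \sum_{e \in E(T)} q^{\mathrm{inv}(w_e)} \qquad \text{and} \qquad f_{\mathrm{Tree}'}^T = 1.$$
   Context: A plane binary tree is a tree embedded in the plane with a unique root node having exactly one child, internal nodes each having exactly two (left and right) children, and leaves having no children; if there are $n$ internal nodes the leaves are numbered $0,\dots,n$ from left to right. $\mathcal{T}_p$ is the set of such trees with $p$ internal nodes; $\mathcal{T}_0=\{\emptyset\}$, the tree with a root, no internal nodes and one leaf. Grafting: for $T_1 \in \mathcal{T}_a$, $T_2 \in \mathcal{T}_b$, $T_1 \vee T_2 \in \mathcal{T}_{a+b+1}$ is formed by placing $T_1$ left of $T_2$, identifying their root nodes into a new internal node, and attaching a new root above it. Splicing $T \in \mathcal{T}_p$ at leaf $i$: with $P$ the path from leaf $i$ to the root, the edges weakly left of $P$ form $T_1 \in \mathcal{T}_i$ and those weakly right of $P$ form $T_2 \in \mathcal{T}_{p-i}$; $\mathrm{SG}(T,i) = T_1 \vee T_2$. For $p\ge1$, $T^*$ is obtained from $T$ by removing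 leaf $0$ and erasing the internal node it is attached to. A linear extension of $T \in \mathcal{T}_p$ is a bijection $e$ from the internal nodes of $T$ to $\{1,\dots,p\}$ such that each internal node receives a larger label than all of its internal-node ancestors; $E(T)$ is the set of linear extensions. $w_e \in S_p$ is the permutation obtained by reading the labels of the internal nodes from left to right in the plane (symmetric/in-order: left subtree, then the node, then right subtree). $\mathrm{inv}(w)$ is the number of inversions of $w$. -}

module Defs where

open import Data.Nat using (ℕ; zero; suc; _+_; _∸_; _≤ᵇ_; _<ᵇ_; _≡ᵇ_)
open import Data.Bool using (Bool; true; false; _∧_; if_then_else_)
open import Data.List using (List; []; _∷_; _++_; map; concatMap; upTo; length; foldr)
open import Data.Product using (_×_; _,_; proj₁; proj₂)
open import Algebra.Bundles using (CommutativeSemiring)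

-- Plane binary trees.  leaf = ∅ (no internal node, one leaf);
-- l ⋁ r = grafting of l (left) and r (right).

infixr 5 _⋁_
data Tree : Set where
  leaf : Tree
  _⋁_  : Tree → Tree → Tree

size : Tree → ℕ
size leaf      = 0
size (l ⋁ r)   = size l + size r + 1

eqT : Tree → Tree → Bool
eqT leaf      leaf        = true
eqT leaf      (_ ⋁ _)     = false
eqT (_ ⋁ _)   leaf        = false
eqT (l ⋁ r)   (l' ⋁ r')   = eqT l l' ∧ eqT r r'

-- Splitting along the path from leaf i to the root: (T₁ , T₂) with
-- T₁ the edges weakly left of the path, T₂ those weakly right of it.
-- Leaves of l ⋁ r: leaves 0..size l are in l, the rest in r.
split : Tree → ℕ → Tree × Tree
split leaf    i = leaf , leaf
split (l ⋁ r) i with i ≤ᵇ size l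
... | true  = proj₁ (split l i) , (proj₂ (split l i) ⋁ r)
... | false = (l ⋁ proj₁ (split r (i ∸ suc (size l)))) , proj₂ (split r (i ∸ suc (size l)))

SG : Tree → ℕ → Tree
SG t i = proj₁ (split t i) ⋁ proj₂ (split t i)

-- T* : remove leaf 0 and erase the internal node it is attached to
-- (only meaningful for trees with at least one internal node)
star : Tree → Tree
star leaf            = leaf
star (leaf ⋁ r)      = r
star ((a ⋁ b) ⋁ r)   = star (a ⋁ b) ⋁ r

-- Splicing sequences ∅ = T₀, T₁, …, T_j with T_k = SG(T_{k-1}, i_k),
-- i_k ∈ {0,…,k-1}; one entry (T_j , i₁ + ⋯ + i_j) per choice sequence.

sgSeqs : ℕ → List (Tree × ℕ)
sgSeqs zero    = (leaf , 0) ∷ []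
sgSeqs (suc j) =
  concatMap (λ ts → map (λ i → SG (proj₁ ts) i , proj₂ ts + i) (upTo (suc j)))
            (sgSeqs j)

-- Internal nodes are indexed 0..p-1 by their
-- in-order (symmetric order) position, so a labelling e is a word
-- w = w_e of length p (w at position k = label of the k-th node).

allWords : ℕ → List ℕ → List (List ℕ)
allWords zero    A = [] ∷ []
allWords (suc n) A = concatMap (λ a → map (a ∷_) (allWords n A)) A

memb : ℕ → List ℕ → Bool
memb x []       = false
memb x (y ∷ ys) = if x ≡ᵇ y then true else memb x ys

distinct : List ℕ → Bool
distinct []       = true
distinct (x ∷ xs) = if memb x xs then false else distinct xs

nth : List ℕ → ℕ → ℕ
nth []       _       = 0
nth (x ∷ xs) zero    = x
nth (x ∷ xs) (suc k) = nth xs k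

allB : {A : Set} → (A → Bool) → List A → Bool
allB f []       = true
allB f (x ∷ xs) = f x ∧ allB f xs

countB : {A : Set} → (A → Bool) → List A → ℕ
countB f []       = 0
countB f (x ∷ xs) = (if f x then 1 else 0) + countB f xs

ancPairs : Tree → List (ℕ × ℕ)
ancPairs leaf    = []
ancPairs (l ⋁ r) =
  map (λ d → size l , d) (upTo (size l) ++ map (λ x → suc (size l) + x) (upTo (size r)))
  ++ ancPairs l
  ++ map (λ ad → suc (size l) + proj₁ ad , suc (size l) + proj₂ ad) (ancPairs r)

-- w (of length p, letters in {1..p}) is a linear extension of T:
-- bijective (distinct letters) and every node's label exceeds its ancestors'.
isLinExt : Tree → List ℕ → Bool
isLinExt T w = distinct w ∧ allB (λ ad → nth w (proj₁ ad) <ᵇ nth w (proj₂ ad)) (ancPairs T)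

labellings : ℕ → List (List ℕ)
labellings p = allWords p (map suc (upTo p))

inv : List ℕ → ℕ
inv []       = 0
inv (x ∷ xs) = countB (λ y → y <ᵇ x) xs + inv xs

treesDepth : ℕ → List Tree
treesDepth zero    = leaf ∷ []
treesDepth (suc d) = leaf ∷ concatMap (λ l → map (l ⋁_) (treesDepth d)) (treesDepth d)

-- 𝒯_n (every tree with n internal nodes has depth ≤ n)
allTrees : ℕ → List Tree
allTrees n = concatMap (λ t → if size t ≡ᵇ n then t ∷ [] else []) (treesDepth n)

headT : List Tree → Tree
headT []      = leaf
headT (t ∷ _) = t

-- sequences stored reversed: T_j ∷ T_{j-1} ∷ ⋯ ∷ T₀
starSeqs : ℕ → List (List Tree)
starSeqs zero    = (leaf ∷ []) ∷ []
starSeqs (suc j) =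
  concatMap (λ s → concatMap (λ t → if eqT (star t) (headT s) then (t ∷ s) ∷ [] else [])
                             (allTrees (suc j)))
            (starSeqs j)

fTree' : ℕ → Tree → ℕ
fTree' p T = countB (λ s → eqT (headT s) T) (starSeqs p)

-- Generating functions, evaluated at an element q of an arbitrary
-- commutative semiring (equality in all of them = polynomial identity).

module _ {c ℓ} (R : CommutativeSemiring c ℓ) where
  open CommutativeSemiring R using (Carrier; 0#; 1#) renaming (_+_ to _⊕_; _*_ to _⊛_)

  pow : Carrier → ℕ → Carrier
  pow q zero    = 1#
  pow q (suc n) = q ⊛ pow q n

  sumR : List Carrier → Carrier
  sumR = foldr _⊕_ 0#

  fTree : Carrier → ℕ → Tree → Carrier
  fTree q p T = sumR (map (λ ts → if eqT (proj₁ ts) T then pow q (proj₂ ts) else 0#) (sgSeqs p))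

  extSum : Carrier → ℕ → Tree → Carrier
  extSum q p T = sumR (map (λ w → if isLinExt T w then pow q (inv w) else 0#) (labellings p))

-- Reading the labels of a linear extension of T in symmetric order gives a word w with distinct
-- letters, and the heap condition says exactly that T is the Cartesian tree of w (root at the
-- minimal letter, subtrees the Cartesian trees of the factors left and right of it); a word has
-- only one Cartesian tree.  Splicing at leaf i corresponds to shifting all letters up by one and
-- inserting the new minimum 1 at position i, which creates exactly i inversions.  So splicing
-- sequences ending in T carry words whose Cartesian tree is T, with i₁ + ⋯ + i_p = inv w, and
-- choosing the position of the letter 1 shows that every permutation arises exactly once.
-- For the second identity, T_{j-1} = T_j* is determined by T_j, so exactly one chain ends in T.

module Submission where

open import Defs
open import Algebra.Bundles using (CommutativeSemiring)
open import Data.Bool using (Bool; true; false; T; _∧_; if_then_else_)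
open import Data.Bool.Properties using (∧-comm; ∧-assoc; ∧-zeroʳ; ∧-identityʳ; if-∧)
open import Data.Empty using (⊥; ⊥-elim)
open import Data.List
  using (List; []; _∷_; _++_; map; concat; concatMap; length; take; drop; upTo; applyUpTo)
open import Data.List.Properties
  using (∷-injective; ∷-injectiveʳ; length-++; length-map; length-applyUpTo; map-++; map-∘;
         map-cong-local; map-applyUpTo; concatMap-map; map-concatMap; take-[]; drop-[])
open import Data.List.Relation.Unary.All using (All; []; _∷_)
import Data.List.Relation.Unary.All as All
open import Data.List.Relation.Unary.All.Properties
  using (++⁺; ++⁻ʳ; take⁺; drop⁺; map⁺; concat⁺; all-upTo; applyUpTo⁺₂)
open import Data.Nat using (ℕ; zero; suc; _+_; _*_; _∸_; _≤_; _<_; _≡ᵇ_; _≤ᵇ_; _<ᵇ_; _⊔_; z≤n; s≤s)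
open import Data.Nat.Properties
  using (≡ᵇ⇒≡; ≡⇒≡ᵇ; ≤ᵇ⇒≤; ≤⇒≤ᵇ; <ᵇ⇒<; <⇒<ᵇ; ≰⇒>; suc-injective;
         +-comm; +-assoc; +-identityʳ; +-suc; +-cancelˡ-≡; +-monoʳ-<; +-commutativeSemigroup;
         *-comm; *-zeroʳ; *-identityʳ; *-distribʳ-+; m+[n∸m]≡n;
         ≤-trans; ≤-reflexive; ≤-pred; <-trans; <-asym; m≤m+n; m≤n+m; ⊔-lub; m≤m⊔n; m≤n⊔m)
open import Algebra.Properties.CommutativeSemigroup +-commutativeSemigroup
  using () renaming (x∙yz≈y∙xz to x+[y+z]≡y+[x+z])
open import Data.Product using (_×_; _,_; proj₁; proj₂; ∃-syntax)
open import Relation.Binary.PropositionalEquality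
  using (_≡_; refl; sym; trans; cong; cong₂; subst; module ≡-Reasoning)
import Relation.Binary.PropositionalEquality as ≡

true≢false : true ≡ false → ⊥
true≢false ()

T⇒≡true : ∀ {b} → T b → b ≡ true
T⇒≡true {true} _ = refl

≡true⇒T : ∀ {b} → b ≡ true → T b
≡true⇒T refl = _

∧≡true⇒ : ∀ {a b} → a ∧ b ≡ true → a ≡ true × b ≡ true
∧≡true⇒ {true} {true} _ = refl , refl

≡ᵇ≡true⇒≡ : ∀ {m n} → (m ≡ᵇ n) ≡ true → m ≡ n
≡ᵇ≡true⇒≡ {m} {n} e = ≡ᵇ⇒≡ m n (≡true⇒T e)

≡ᵇ-refl : ∀ n → (n ≡ᵇ n) ≡ true
≡ᵇ-refl n = T⇒≡true (≡⇒≡ᵇ n n refl)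

≡ᵇ-sym : ∀ m n → (m ≡ᵇ n) ≡ (n ≡ᵇ m)
≡ᵇ-sym zero    zero    = refl
≡ᵇ-sym zero    (suc n) = refl
≡ᵇ-sym (suc m) zero    = refl
≡ᵇ-sym (suc m) (suc n) = ≡ᵇ-sym m n

≤ᵇ≡true⇒≤ : ∀ {m n} → (m ≤ᵇ n) ≡ true → m ≤ n
≤ᵇ≡true⇒≤ {m} {n} e = ≤ᵇ⇒≤ m n (≡true⇒T e)

≤ᵇ≡false⇒> : ∀ {m n} → (m ≤ᵇ n) ≡ false → n < m
≤ᵇ≡false⇒> {m} {n} e = ≰⇒> (λ m≤n → true≢false (trans (sym (T⇒≡true (≤⇒≤ᵇ m≤n))) e))

<⇒<ᵇ≡true : ∀ {m n} → m < n → (m <ᵇ n) ≡ true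
<⇒<ᵇ≡true m<n = T⇒≡true (<⇒<ᵇ m<n)

size-⋁ : ∀ l r → size (l ⋁ r) ≡ suc (size l + size r)
size-⋁ l r = +-comm (size l + size r) 1

eqT-refl : ∀ t → eqT t t ≡ true
eqT-refl leaf    = refl
eqT-refl (l ⋁ r) = cong₂ _∧_ (eqT-refl l) (eqT-refl r)

eqT⇒≡ : ∀ {s t} → eqT s t ≡ true → s ≡ t
eqT⇒≡ {leaf}  {leaf}  _ = refl
eqT⇒≡ {a ⋁ b} {c ⋁ d} e with ∧≡true⇒ {eqT a c} e
... | e₁ , e₂ = cong₂ _⋁_ (eqT⇒≡ e₁) (eqT⇒≡ e₂)

eqT-sym : ∀ s t → eqT s t ≡ eqT t s
eqT-sym leaf    leaf    = refl
eqT-sym leaf    (_ ⋁ _) = refl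
eqT-sym (_ ⋁ _) leaf    = refl
eqT-sym (a ⋁ b) (c ⋁ d) = cong₂ _∧_ (eqT-sym a c) (eqT-sym b d)

eqT-∧-subst : ∀ (h : Tree → Bool) t T → h t ∧ eqT t T ≡ eqT t T ∧ h T
eqT-∧-subst h t T with eqT t T in e
... | false = ∧-zeroʳ (h t)
... | true with eqT⇒≡ {t} e
...   | refl = ∧-comm (h t) true

⟦_⟧ : Bool → ℕ
⟦ b ⟧ = if b then 1 else 0

countB-false : {A : Set} (xs : List A) → countB (λ _ → false) xs ≡ 0
countB-false []       = refl
countB-false (_ ∷ xs) = countB-false xs

countB-cong : {A : Set} {f g : A → Bool} → (∀ x → f x ≡ g x) → ∀ xs → countB f xs ≡ countB g xs
countB-cong e []       = refl
countB-cong e (x ∷ xs) = cong₂ (λ b n → ⟦ b ⟧ + n) (e x) (countB-cong e xs)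

countB-++ : {A : Set} (f : A → Bool) (xs ys : List A) →
            countB f (xs ++ ys) ≡ countB f xs + countB f ys
countB-++ f []       ys = refl
countB-++ f (x ∷ xs) ys = trans (cong (⟦ f x ⟧ +_) (countB-++ f xs ys)) (sym (+-assoc ⟦ f x ⟧ _ _))

countB-map : {A B : Set} (f : B → Bool) (g : A → B) (xs : List A) →
             countB f (map g xs) ≡ countB (λ x → f (g x)) xs
countB-map f g []       = refl
countB-map f g (x ∷ xs) = cong (⟦ f (g x) ⟧ +_) (countB-map f g xs)

countB-∧ʳ : {A : Set} (f : A → Bool) (b : Bool) (xs : List A) →
            countB (λ x → f x ∧ b) xs ≡ countB f xs * ⟦ b ⟧
countB-∧ʳ f false xs = trans (countB-cong (λ x → ∧-zeroʳ (f x)) xs)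
                             (trans (countB-false xs) (sym (*-zeroʳ (countB f xs))))
countB-∧ʳ f true  xs = trans (countB-cong (λ x → ∧-identityʳ (f x)) xs) (sym (*-identityʳ (countB f xs)))

countB-∧ˡ : {A : Set} (b : Bool) (f : A → Bool) (xs : List A) →
            countB (λ x → b ∧ f x) xs ≡ ⟦ b ⟧ * countB f xs
countB-∧ˡ b f xs = trans (countB-cong (λ x → ∧-comm b (f x)) xs)
                         (trans (countB-∧ʳ f b xs) (*-comm (countB f xs) ⟦ b ⟧))

countB-guard : {A B : Set} (f : B → Bool) (c : A → Bool) (g : A → B) (xs : List A) →
               countB f (concatMap (λ x → if c x then g x ∷ [] else []) xs)
               ≡ countB (λ x → c x ∧ f (g x)) xs
countB-guard f c g []       = refl
countB-guard f c g (x ∷ xs) with c x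
... | true  = cong (⟦ f (g x) ⟧ +_) (countB-guard f c g xs)
... | false = countB-guard f c g xs

*-⟦⟧-absorb : ∀ n b → (b ≡ true → n ≡ 1) → n * ⟦ b ⟧ ≡ ⟦ b ⟧
*-⟦⟧-absorb n false _   = *-zeroʳ n
*-⟦⟧-absorb n true  n≡1 = cong (_* 1) (n≡1 refl)

-- Chains of stars

depth : Tree → ℕ
depth leaf    = 0
depth (l ⋁ r) = suc (depth l ⊔ depth r)

depth≤size : ∀ t → depth t ≤ size t
depth≤size leaf    = z≤n
depth≤size (l ⋁ r) =
  ≤-trans (s≤s (⊔-lub (≤-trans (depth≤size l) (m≤m+n (size l) (size r)))
                      (≤-trans (depth≤size r) (m≤n+m (size r) (size l)))))
          (≤-reflexive (sym (size-⋁ l r)))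

countB-grafts-leaf : ∀ us ts →
  countB (λ t → eqT t leaf) (concatMap (λ l → map (l ⋁_) ts) us) ≡ 0
countB-grafts-leaf []       ts = refl
countB-grafts-leaf (u ∷ us) ts =
  trans (countB-++ _ (map (u ⋁_) ts) _)
        (cong₂ _+_ (trans (countB-map _ (u ⋁_) ts) (countB-false ts)) (countB-grafts-leaf us ts))

countB-grafts : ∀ a b us ts →
  countB (λ t → eqT t (a ⋁ b)) (concatMap (λ l → map (l ⋁_) ts) us)
  ≡ countB (λ l → eqT l a) us * countB (λ r → eqT r b) ts
countB-grafts a b []       ts = refl
countB-grafts a b (u ∷ us) ts = begin
  countB f (map (u ⋁_) ts ++ grafts us)
    ≡⟨ countB-++ f (map (u ⋁_) ts) (grafts us) ⟩
  countB f (map (u ⋁_) ts) + countB f (grafts us)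
    ≡⟨ cong₂ _+_ (trans (countB-map f (u ⋁_) ts) (countB-∧ˡ (eqT u a) (λ r → eqT r b) ts))
                 (countB-grafts a b us ts) ⟩
  ⟦ eqT u a ⟧ * countB (λ r → eqT r b) ts + countB (λ l → eqT l a) us * countB (λ r → eqT r b) ts
    ≡⟨ sym (*-distribʳ-+ (countB (λ r → eqT r b) ts) ⟦ eqT u a ⟧ _) ⟩
  countB (λ l → eqT l a) (u ∷ us) * countB (λ r → eqT r b) ts ∎
  where
  open ≡-Reasoning
  f : Tree → Bool
  f t = eqT t (a ⋁ b)
  grafts : List Tree → List Tree
  grafts = concatMap (λ l → map (l ⋁_) ts)

treesDepth-count : ∀ d T → depth T ≤ d → countB (λ t → eqT t T) (treesDepth d) ≡ 1
treesDepth-count zero    leaf    _        = refl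
treesDepth-count (suc d) leaf    _        = cong suc (countB-grafts-leaf (treesDepth d) (treesDepth d))
treesDepth-count (suc d) (a ⋁ b) (s≤s le) =
  trans (countB-grafts a b (treesDepth d) (treesDepth d))
        (cong₂ _*_ (treesDepth-count d a (≤-trans (m≤m⊔n (depth a) (depth b)) le))
                   (treesDepth-count d b (≤-trans (m≤n⊔m (depth a) (depth b)) le)))

allTrees-count : ∀ n T → countB (λ t → eqT t T) (allTrees n) ≡ ⟦ size T ≡ᵇ n ⟧
allTrees-count n T = begin
  countB (λ t → eqT t T) (allTrees n)
    ≡⟨ countB-guard (λ t → eqT t T) (λ t → size t ≡ᵇ n) (λ t → t) (treesDepth n) ⟩
  countB (λ t → (size t ≡ᵇ n) ∧ eqT t T) (treesDepth n)
    ≡⟨ countB-cong (λ t → eqT-∧-subst (λ t → size t ≡ᵇ n) t T) (treesDepth n) ⟩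
  countB (λ t → eqT t T ∧ (size T ≡ᵇ n)) (treesDepth n)
    ≡⟨ countB-∧ʳ (λ t → eqT t T) (size T ≡ᵇ n) (treesDepth n) ⟩
  countB (λ t → eqT t T) (treesDepth n) * ⟦ size T ≡ᵇ n ⟧
    ≡⟨ *-⟦⟧-absorb _ (size T ≡ᵇ n) (λ e →
         treesDepth-count n T (≤-trans (depth≤size T) (≤-reflexive (≡ᵇ≡true⇒≡ e)))) ⟩
  ⟦ size T ≡ᵇ n ⟧ ∎
  where open ≡-Reasoning

countB-starStep : ∀ T (ts : List Tree) (ss : List (List Tree)) →
  countB (λ s → eqT (headT s) T)
         (concatMap (λ s → concatMap (λ t → if eqT (star t) (headT s) then (t ∷ s) ∷ [] else []) ts) ss)
  ≡ countB (λ s → eqT (headT s) (star T)) ss * countB (λ t → eqT t T) ts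
countB-starStep T ts []       = refl
countB-starStep T ts (s ∷ ss) = begin
  countB f (extend s ++ concatMap extend ss)
    ≡⟨ countB-++ f (extend s) (concatMap extend ss) ⟩
  countB f (extend s) + countB f (concatMap extend ss)
    ≡⟨ cong₂ _+_ extend-count (countB-starStep T ts ss) ⟩
  ⟦ eqT (headT s) (star T) ⟧ * countB (λ t → eqT t T) ts
    + countB (λ s → eqT (headT s) (star T)) ss * countB (λ t → eqT t T) ts
    ≡⟨ sym (*-distribʳ-+ (countB (λ t → eqT t T) ts) ⟦ eqT (headT s) (star T) ⟧ _) ⟩
  countB (λ s → eqT (headT s) (star T)) (s ∷ ss) * countB (λ t → eqT t T) ts ∎
  where
  open ≡-Reasoning
  f : List Tree → Bool
  f s = eqT (headT s) T
  extend : List Tree → List (List Tree)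
  extend s = concatMap (λ t → if eqT (star t) (headT s) then (t ∷ s) ∷ [] else []) ts
  extend-count : countB f (extend s) ≡ ⟦ eqT (headT s) (star T) ⟧ * countB (λ t → eqT t T) ts
  extend-count = begin
    countB f (extend s)
      ≡⟨ countB-guard f (λ t → eqT (star t) (headT s)) (_∷ s) ts ⟩
    countB (λ t → eqT (star t) (headT s) ∧ eqT t T) ts
      ≡⟨ countB-cong (λ t → eqT-∧-subst (λ t → eqT (star t) (headT s)) t T) ts ⟩
    countB (λ t → eqT t T ∧ eqT (star T) (headT s)) ts
      ≡⟨ countB-∧ʳ (λ t → eqT t T) (eqT (star T) (headT s)) ts ⟩
    countB (λ t → eqT t T) ts * ⟦ eqT (star T) (headT s) ⟧
      ≡⟨ *-comm (countB (λ t → eqT t T) ts) ⟦ eqT (star T) (headT s) ⟧ ⟩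
    ⟦ eqT (star T) (headT s) ⟧ * countB (λ t → eqT t T) ts
      ≡⟨ cong (λ b → ⟦ b ⟧ * countB (λ t → eqT t T) ts) (eqT-sym (star T) (headT s)) ⟩
    ⟦ eqT (headT s) (star T) ⟧ * countB (λ t → eqT t T) ts ∎

suc-size-star : ∀ l r → suc (size (star (l ⋁ r))) ≡ size (l ⋁ r)
suc-size-star leaf    r = +-comm 1 (size r)
suc-size-star (a ⋁ b) r = cong (λ n → n + size r + 1) (suc-size-star a b)

size-star : ∀ {n} T → size T ≡ suc n → size (star T) ≡ n
size-star (l ⋁ r) e = suc-injective (trans (suc-size-star l r) e)

starSeqs-count : ∀ j T → countB (λ s → eqT (headT s) T) (starSeqs j) ≡ ⟦ size T ≡ᵇ j ⟧
starSeqs-count zero    leaf    = refl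
starSeqs-count zero    (a ⋁ b) = sym (cong (λ n → ⟦ n ≡ᵇ 0 ⟧) (size-⋁ a b))
starSeqs-count (suc j) T = begin
  countB (λ s → eqT (headT s) T) (starSeqs (suc j))
    ≡⟨ countB-starStep T (allTrees (suc j)) (starSeqs j) ⟩
  countB (λ s → eqT (headT s) (star T)) (starSeqs j) * countB (λ t → eqT t T) (allTrees (suc j))
    ≡⟨ cong₂ _*_ (starSeqs-count j (star T)) (allTrees-count (suc j) T) ⟩
  ⟦ size (star T) ≡ᵇ j ⟧ * ⟦ size T ≡ᵇ suc j ⟧
    ≡⟨ *-⟦⟧-absorb _ (size T ≡ᵇ suc j) (λ e →
         cong ⟦_⟧ (trans (cong (_≡ᵇ j) (size-star T (≡ᵇ≡true⇒≡ e))) (≡ᵇ-refl j))) ⟩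
  ⟦ size T ≡ᵇ suc j ⟧ ∎
  where open ≡-Reasoning

fTree'≡1 : ∀ p T → size T ≡ p → fTree' p T ≡ 1
fTree'≡1 p T refl = trans (starSeqs-count (size T) T) (cong ⟦_⟧ (≡ᵇ-refl (size T)))

module _ {A : Set} where

  take-++ˡ : ∀ i (L ys : List A) → i ≤ length L → take i (L ++ ys) ≡ take i L
  take-++ˡ zero    L       ys _         = refl
  take-++ˡ (suc i) (x ∷ L) ys (s≤s i≤L) = cong (x ∷_) (take-++ˡ i L ys i≤L)

  drop-++ˡ : ∀ i (L ys : List A) → i ≤ length L → drop i (L ++ ys) ≡ drop i L ++ ys
  drop-++ˡ zero    L       ys _         = refl
  drop-++ˡ (suc i) (x ∷ L) ys (s≤s i≤L) = drop-++ˡ i L ys i≤L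

  take-++ʳ : ∀ (L : List A) k ys → take (length L + k) (L ++ ys) ≡ L ++ take k ys
  take-++ʳ []      k ys = refl
  take-++ʳ (x ∷ L) k ys = cong (x ∷_) (take-++ʳ L k ys)

  drop-++ʳ : ∀ (L : List A) k ys → drop (length L + k) (L ++ ys) ≡ drop k ys
  drop-++ʳ []      k ys = refl
  drop-++ʳ (x ∷ L) k ys = drop-++ʳ L k ys

length-++-∷ : ∀ (L : List ℕ) m R → length (L ++ m ∷ R) ≡ suc (length L + length R)
length-++-∷ L m R = trans (length-++ L) (+-suc (length L) (length R))

splitAt-∷ : ∀ (w : List ℕ) k → k < length w → ∃[ L ] ∃[ x ] ∃[ R ] (w ≡ L ++ x ∷ R × length L ≡ k)
splitAt-∷ (y ∷ w) zero    _         = [] , y , w , refl , refl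
splitAt-∷ (y ∷ w) (suc k) (s≤s k<w) with splitAt-∷ w k k<w
... | L , x , R , refl , refl = y ∷ L , x , R , refl , refl

nth-++ˡ : ∀ (L ys : List ℕ) {i} → i < length L → nth (L ++ ys) i ≡ nth L i
nth-++ˡ (x ∷ L) ys {zero}  _         = refl
nth-++ˡ (x ∷ L) ys {suc i} (s≤s i<L) = nth-++ˡ L ys i<L

nth-++-∷ : ∀ (L : List ℕ) x R → nth (L ++ x ∷ R) (length L) ≡ x
nth-++-∷ []      x R = refl
nth-++-∷ (y ∷ L) x R = nth-++-∷ L x R

nth-++-∷-shift : ∀ (L : List ℕ) x R e → nth (L ++ x ∷ R) (suc (length L) + e) ≡ nth R e
nth-++-∷-shift []      x R e = refl
nth-++-∷-shift (y ∷ L) x R e = nth-++-∷-shift L x R e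

module _ {A : Set} where

  allB-++ : (f : A → Bool) (xs ys : List A) → allB f (xs ++ ys) ≡ allB f xs ∧ allB f ys
  allB-++ f []       ys = refl
  allB-++ f (x ∷ xs) ys = trans (cong (f x ∧_) (allB-++ f xs ys)) (sym (∧-assoc (f x) _ _))

  allB-map : {B : Set} (f : B → Bool) (g : A → B) (xs : List A) → allB f (map g xs) ≡ allB (λ x → f (g x)) xs
  allB-map f g []       = refl
  allB-map f g (x ∷ xs) = cong (f (g x) ∧_) (allB-map f g xs)

  allB-cong : {f g : A → Bool} {xs : List A} → All (λ x → f x ≡ g x) xs → allB f xs ≡ allB g xs
  allB-cong []           = refl
  allB-cong (fx≡gx ∷ eqs) = cong₂ _∧_ fx≡gx (allB-cong eqs)

allB-upTo-cong : ∀ {f g : ℕ → Bool} n → (∀ {i} → i < n → f i ≡ g i) → allB f (upTo n) ≡ allB g (upTo n)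
allB-upTo-cong n e = allB-cong (All.map e (all-upTo n))

allB-nth : ∀ (f : ℕ → Bool) (L : List ℕ) → allB (λ d → f (nth L d)) (upTo (length L)) ≡ allB f L
allB-nth f []      = refl
allB-nth f (a ∷ L) = cong (f a ∧_) (begin
  allB (λ d → f (nth (a ∷ L) d)) (applyUpTo suc (length L))
    ≡⟨ cong (allB _) (sym (map-applyUpTo (λ i → i) suc (length L))) ⟩
  allB (λ d → f (nth (a ∷ L) d)) (map suc (upTo (length L)))
    ≡⟨ allB-map (λ d → f (nth (a ∷ L) d)) suc (upTo (length L)) ⟩
  allB (λ d → f (nth L d)) (upTo (length L))
    ≡⟨ allB-nth f L ⟩
  allB f L ∎)
  where open ≡-Reasoning

All⇒allB-<ᵇ : ∀ {x L} → All (x <_) L → allB (x <ᵇ_) L ≡ true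
All⇒allB-<ᵇ []            = refl
All⇒allB-<ᵇ (x<y ∷ x<L)   = cong₂ _∧_ (<⇒<ᵇ≡true x<y) (All⇒allB-<ᵇ x<L)

allB-<ᵇ⇒All : ∀ x L → allB (x <ᵇ_) L ≡ true → All (x <_) L
allB-<ᵇ⇒All x []      _ = []
allB-<ᵇ⇒All x (y ∷ L) h with ∧≡true⇒ {x <ᵇ y} h
... | x<y , x<L = <ᵇ⇒< x y (≡true⇒T x<y) ∷ allB-<ᵇ⇒All x L x<L

-- Cartesian trees

data Cartesian : List ℕ → Tree → Set where
  empty : Cartesian [] leaf
  node  : ∀ {L m R l r} → All (m <_) L → All (m <_) R →
          Cartesian L l → Cartesian R r → Cartesian (L ++ m ∷ R) (l ⋁ r)

Cartesian-size : ∀ {w t} → Cartesian w t → size t ≡ length w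
Cartesian-size empty = refl
Cartesian-size (node {L} {m} {R} {l} {r} _ _ cL cR) =
  trans (size-⋁ l r)
        (trans (cong suc (cong₂ _+_ (Cartesian-size cL) (Cartesian-size cR))) (sym (length-++-∷ L m R)))

-- m' would lie both below m (it is below a = m) and above it (it occurs in R).
no-later-minimum : ∀ {m R a m' R'} L' → m ∷ R ≡ a ∷ L' ++ m' ∷ R' →
                   All (m <_) R → All (m' <_) (a ∷ L') → ⊥
no-later-minimum L' eq m<R (m'<a ∷ _) with ∷-injective eq
... | refl , R≡ = <-asym m'<a (All.head (++⁻ʳ L' (subst (All _) R≡ m<R)))

minimum-split-unique : ∀ L {m R} L' {m' R'} → L ++ m ∷ R ≡ L' ++ m' ∷ R' →
                       All (m <_) L → All (m <_) R → All (m' <_) L' → All (m' <_) R' →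
                       L ≡ L' × R ≡ R'
minimum-split-unique []      []       eq _ _ _ _ = refl , ∷-injectiveʳ eq
minimum-split-unique []      (a ∷ L') eq _ m<R m'<L' _ = ⊥-elim (no-later-minimum L' eq m<R m'<L')
minimum-split-unique (a ∷ L) []       eq m<L _ _ m'<R' = ⊥-elim (no-later-minimum L (sym eq) m'<R' m<L)
minimum-split-unique (a ∷ L) (a' ∷ L') eq (_ ∷ m<L) m<R (_ ∷ m'<L') m'<R' with ∷-injective eq
... | refl , eq' with minimum-split-unique L L' eq' m<L m<R m'<L' m'<R'
...   | refl , refl = refl , refl

Cartesian-functional : ∀ {w w' t t'} → Cartesian w t → Cartesian w' t' → w ≡ w' → t ≡ t'
Cartesian-functional empty empty _ = refl
Cartesian-functional empty (node {L = []}    _ _ _ _) ()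
Cartesian-functional empty (node {L = _ ∷ _} _ _ _ _) ()
Cartesian-functional (node {L = []}    _ _ _ _) empty ()
Cartesian-functional (node {L = _ ∷ _} _ _ _ _) empty ()
Cartesian-functional (node {L} m<L m<R cL cR) (node {L'} m'<L' m'<R' cL' cR') eq
  with minimum-split-unique L L' eq m<L m<R m'<L' m'<R'
... | refl , refl = cong₂ _⋁_ (Cartesian-functional cL cL' refl) (Cartesian-functional cR cR' refl)

Cartesian-split : ∀ {w t} → Cartesian w t → ∀ i →
                  Cartesian (take i w) (proj₁ (split t i)) × Cartesian (drop i w) (proj₂ (split t i))
Cartesian-split empty i rewrite take-[] {A = ℕ} i | drop-[] {A = ℕ} i = empty , empty
Cartesian-split (node {L} {m} {R} {l} {r} m<L m<R cL cR) i with i ≤ᵇ size l in c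
... | true =
  subst (λ w → Cartesian w _) (sym (take-++ˡ i L (m ∷ R) i≤L)) (proj₁ (Cartesian-split cL i)) ,
  subst (λ w → Cartesian w _) (sym (drop-++ˡ i L (m ∷ R) i≤L))
        (node (drop⁺ i m<L) m<R (proj₂ (Cartesian-split cL i)) cR)
  where i≤L : i ≤ length L
        i≤L = subst (i ≤_) (Cartesian-size cL) (≤ᵇ≡true⇒≤ c)
... | false =
  subst (λ w → Cartesian w _) (trans (sym (take-++ʳ L (suc j) (m ∷ R))) (cong (λ k → take k _) i≡))
        (node m<L (take⁺ j m<R) cL (proj₁ (Cartesian-split cR j))) ,
  subst (λ w → Cartesian w _) (trans (sym (drop-++ʳ L (suc j) (m ∷ R))) (cong (λ k → drop k _) i≡))
        (proj₂ (Cartesian-split cR j))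
  where j : ℕ
        j = i ∸ suc (size l)
        i≡ : length L + suc j ≡ i
        i≡ = trans (+-suc (length L) j)
                   (trans (cong (λ n → suc n + j) (sym (Cartesian-size cL))) (m+[n∸m]≡n (≤ᵇ≡false⇒> c)))

insertAt : ℕ → ℕ → List ℕ → List ℕ
insertAt i x v = take i v ++ x ∷ drop i v

length-insertAt : ∀ i x v → length (insertAt i x v) ≡ suc (length v)
length-insertAt zero    x v       = refl
length-insertAt (suc i) x []      = refl
length-insertAt (suc i) x (y ∷ v) = cong suc (length-insertAt i x v)

Cartesian-map-suc : ∀ {w t} → Cartesian w t → Cartesian (map suc w) t
Cartesian-map-suc empty = empty
Cartesian-map-suc (node {L} {m} {R} m<L m<R cL cR) =
  subst (λ w → Cartesian w _) (sym (map-++ suc L (m ∷ R)))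
        (node (map⁺ (All.map s≤s m<L)) (map⁺ (All.map s≤s m<R)) (Cartesian-map-suc cL) (Cartesian-map-suc cR))

Cartesian-insertAt : ∀ {w t} → All (1 ≤_) w → Cartesian w t → ∀ i →
                     Cartesian (insertAt i 1 (map suc w)) (SG t i)
Cartesian-insertAt 1≤w c i =
  node (take⁺ i 1<v) (drop⁺ i 1<v) (proj₁ (Cartesian-split (Cartesian-map-suc c) i))
                                   (proj₂ (Cartesian-split (Cartesian-map-suc c) i))
  where 1<v = map⁺ (All.map s≤s 1≤w)

-- Inversions

countB-insertAt : ∀ (f : ℕ → Bool) i x v → countB f (insertAt i x v) ≡ countB f (x ∷ v)
countB-insertAt f zero    x v       = refl
countB-insertAt f (suc i) x []      = refl
countB-insertAt f (suc i) x (y ∷ v) =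
  trans (cong (⟦ f y ⟧ +_) (countB-insertAt f i x v)) (x+[y+z]≡y+[x+z] ⟦ f y ⟧ ⟦ f x ⟧ (countB f v))

countB-below-minimum : ∀ x v → All (x <_) v → countB (_<ᵇ x) v ≡ 0
countB-below-minimum x []      []           = refl
countB-below-minimum x (y ∷ v) (x<y ∷ x<v) with y <ᵇ x in e
... | true  = ⊥-elim (<-asym x<y (<ᵇ⇒< y x (≡true⇒T e)))
... | false = countB-below-minimum x v x<v

inv-insertAt : ∀ i x v → All (x <_) v → i ≤ length v → inv (insertAt i x v) ≡ inv v + i
inv-insertAt zero    x v       x<v _ = trans (cong (_+ inv v) (countB-below-minimum x v x<v)) (sym (+-identityʳ (inv v)))
inv-insertAt (suc i) x (y ∷ v) (x<y ∷ x<v) (s≤s i≤v) = begin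
  countB (_<ᵇ y) (insertAt i x v) + inv (insertAt i x v)
    ≡⟨ cong₂ _+_ (countB-insertAt (_<ᵇ y) i x v) (inv-insertAt i x v x<v i≤v) ⟩
  ⟦ x <ᵇ y ⟧ + countB (_<ᵇ y) v + (inv v + i)
    ≡⟨ cong (λ b → ⟦ b ⟧ + countB (_<ᵇ y) v + (inv v + i)) (<⇒<ᵇ≡true x<y) ⟩
  suc (countB (_<ᵇ y) v + (inv v + i))
    ≡⟨ cong suc (sym (+-assoc (countB (_<ᵇ y) v) (inv v) i)) ⟩
  suc (countB (_<ᵇ y) v + inv v + i)
    ≡⟨ sym (+-suc (countB (_<ᵇ y) v + inv v) i) ⟩
  inv (y ∷ v) + suc i ∎
  where open ≡-Reasoning

inv-map-suc : ∀ w → inv (map suc w) ≡ inv w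
inv-map-suc []      = refl
inv-map-suc (x ∷ w) = cong₂ _+_ (countB-map (_<ᵇ suc x) suc w) (inv-map-suc w)

inv-insertAt-minimum : ∀ i w → All (1 ≤_) w → i ≤ length w → inv (insertAt i 1 (map suc w)) ≡ inv w + i
inv-insertAt-minimum i w 1≤w i≤w =
  trans (inv-insertAt i 1 (map suc w) (map⁺ (All.map s≤s 1≤w)) (subst (i ≤_) (sym (length-map suc w)) i≤w))
        (cong (_+ i) (inv-map-suc w))

-- Linear extensions

-- isLinExt T w is, by definition, distinct w ∧ heapOrdered T (nth w).
heapOrdered : Tree → (ℕ → ℕ) → Bool
heapOrdered t f = allB (λ ad → f (proj₁ ad) <ᵇ f (proj₂ ad)) (ancPairs t)

heapOrdered-⋁ : ∀ l r f → heapOrdered (l ⋁ r) f ≡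
  (allB (λ d → f (size l) <ᵇ f d) (upTo (size l)) ∧
   allB (λ e → f (size l) <ᵇ f (suc (size l) + e)) (upTo (size r)))
  ∧ (heapOrdered l f ∧ heapOrdered r (λ e → f (suc (size l) + e)))
heapOrdered-⋁ l r f = begin
  allB P (map (size l ,_) descendants ++ ancPairs l ++ map shift (ancPairs r))
    ≡⟨ allB-++ P (map (size l ,_) descendants) (ancPairs l ++ map shift (ancPairs r)) ⟩
  allB P (map (size l ,_) descendants) ∧ allB P (ancPairs l ++ map shift (ancPairs r))
    ≡⟨ cong₂ _∧_ root-part subtree-part ⟩
  (allB (λ d → f (size l) <ᵇ f d) (upTo (size l)) ∧
   allB (λ e → f (size l) <ᵇ f (suc (size l) + e)) (upTo (size r)))
  ∧ (heapOrdered l f ∧ heapOrdered r (λ e → f (suc (size l) + e))) ∎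
  where
  open ≡-Reasoning
  P : ℕ × ℕ → Bool
  P ad = f (proj₁ ad) <ᵇ f (proj₂ ad)
  shift : ℕ × ℕ → ℕ × ℕ
  shift ad = suc (size l) + proj₁ ad , suc (size l) + proj₂ ad
  descendants : List ℕ
  descendants = upTo (size l) ++ map (suc (size l) +_) (upTo (size r))
  root-part : allB P (map (size l ,_) descendants)
            ≡ allB (λ d → f (size l) <ᵇ f d) (upTo (size l)) ∧
              allB (λ e → f (size l) <ᵇ f (suc (size l) + e)) (upTo (size r))
  root-part = trans (allB-map P (size l ,_) descendants)
              (trans (allB-++ (λ d → f (size l) <ᵇ f d) (upTo (size l)) (map (suc (size l) +_) (upTo (size r))))
                     (cong (_ ∧_) (allB-map (λ d → f (size l) <ᵇ f d) (suc (size l) +_) (upTo (size r)))))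
  subtree-part : allB P (ancPairs l ++ map shift (ancPairs r))
               ≡ heapOrdered l f ∧ heapOrdered r (λ e → f (suc (size l) + e))
  subtree-part = trans (allB-++ P (ancPairs l) (map shift (ancPairs r)))
                       (cong (_ ∧_) (allB-map P shift (ancPairs r)))

heapOrdered-local : ∀ t {f g} → (∀ {i} → i < size t → f i ≡ g i) → heapOrdered t f ≡ heapOrdered t g
heapOrdered-local leaf    e = refl
heapOrdered-local (l ⋁ r) {f} {g} e
  rewrite heapOrdered-⋁ l r f | heapOrdered-⋁ l r g =
  cong₂ _∧_ (cong₂ _∧_ (allB-upTo-cong (size l) (λ d<l → cong₂ _<ᵇ_ (e root) (e (<-trans d<l root))))
                       (allB-upTo-cong (size r) (λ d<r → cong₂ _<ᵇ_ (e root) (e (right d<r)))))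
            (cong₂ _∧_ (heapOrdered-local l (λ i<l → e (<-trans i<l root)))
                       (heapOrdered-local r (λ d<r → e (right d<r))))
  where
  root : size l < size (l ⋁ r)
  root = subst (size l <_) (sym (size-⋁ l r)) (s≤s (m≤m+n (size l) (size r)))
  right : ∀ {d} → d < size r → suc (size l) + d < size (l ⋁ r)
  right {d} d<r = subst (suc (size l) + d <_) (sym (size-⋁ l r)) (s≤s (+-monoʳ-< (size l) d<r))

heapOrdered-++-∷ : ∀ l r L x R → length L ≡ size l → length R ≡ size r →
  heapOrdered (l ⋁ r) (nth (L ++ x ∷ R))
  ≡ (allB (x <ᵇ_) L ∧ allB (x <ᵇ_) R) ∧ (heapOrdered l (nth L) ∧ heapOrdered r (nth R))
heapOrdered-++-∷ l r L x R L≡l R≡r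
  rewrite heapOrdered-⋁ l r (nth (L ++ x ∷ R)) | sym L≡l | sym R≡r | nth-++-∷ L x R =
  cong₂ _∧_ (cong₂ _∧_ (trans (allB-upTo-cong (length L) (λ d<L → cong (x <ᵇ_) (nth-++ˡ L (x ∷ R) d<L)))
                              (allB-nth (x <ᵇ_) L))
                       (trans (allB-upTo-cong (length R) (λ {e} _ → cong (x <ᵇ_) (nth-++-∷-shift L x R e)))
                              (allB-nth (x <ᵇ_) R)))
            (cong₂ _∧_ (heapOrdered-local l (λ i<l → nth-++ˡ L (x ∷ R) (subst (_ <_) (sym L≡l) i<l)))
                       (heapOrdered-local r (λ {e} _ → nth-++-∷-shift L x R e)))

Cartesian⇒heapOrdered : ∀ {w t} → Cartesian w t → heapOrdered t (nth w) ≡ true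
Cartesian⇒heapOrdered empty = refl
Cartesian⇒heapOrdered (node {L} {m} {R} {l} {r} m<L m<R cL cR) =
  trans (heapOrdered-++-∷ l r L m R (sym (Cartesian-size cL)) (sym (Cartesian-size cR)))
        (cong₂ _∧_ (cong₂ _∧_ (All⇒allB-<ᵇ m<L) (All⇒allB-<ᵇ m<R))
                   (cong₂ _∧_ (Cartesian⇒heapOrdered cL) (Cartesian⇒heapOrdered cR)))

length-right-factor : ∀ l r L x R → length (L ++ x ∷ R) ≡ size (l ⋁ r) → length L ≡ size l →
                      length R ≡ size r
length-right-factor l r L x R w≡T L≡l =
  +-cancelˡ-≡ (size l) _ _
    (suc-injective (trans (sym (cong (λ n → suc (n + length R)) L≡l))
                          (trans (sym (length-++-∷ L x R)) (trans w≡T (size-⋁ l r)))))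

heapOrdered⇒Cartesian : ∀ T w → length w ≡ size T → heapOrdered T (nth w) ≡ true → Cartesian w T
heapOrdered⇒Cartesian leaf    []      _ _ = empty
heapOrdered⇒Cartesian (l ⋁ r) w w≡T h
  with splitAt-∷ w (size l) (subst (size l <_) (sym (trans w≡T (size-⋁ l r))) (s≤s (m≤m+n (size l) (size r))))
... | L , x , R , refl , L≡l
  with length-right-factor l r L x R w≡T L≡l
... | R≡r with ∧≡true⇒ (trans (sym (heapOrdered-++-∷ l r L x R L≡l R≡r)) h)
... | x<LR , hLR with ∧≡true⇒ x<LR | ∧≡true⇒ hLR
... | x<L , x<R | hL , hR =
  node (allB-<ᵇ⇒All x L x<L) (allB-<ᵇ⇒All x R x<R)
       (heapOrdered⇒Cartesian l L L≡l hL) (heapOrdered⇒Cartesian r R R≡r hR)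

heapOrdered≡eqT : ∀ {w t} T → Cartesian w t → length w ≡ size T → heapOrdered T (nth w) ≡ eqT t T
heapOrdered≡eqT {w} {t} T c w≡T with heapOrdered T (nth w) in h
... | true  = sym (trans (cong (λ s → eqT s T) (Cartesian-functional c (heapOrdered⇒Cartesian T w w≡T h) refl))
                         (eqT-refl T))
... | false with eqT t T in t≡T
...   | false = refl
...   | true with eqT⇒≡ {t} t≡T
...     | refl = ⊥-elim (true≢false (trans (sym (Cartesian⇒heapOrdered c)) h))

-- Splicing sequences

-- (T_j , w) for each splicing sequence ∅ = T₀, …, T_j: step k shifts the letters of w up by one
-- and inserts the new minimal letter 1 at the splice position i_k.
splice : Tree × List ℕ → ℕ → Tree × List ℕ
splice tw i = SG (proj₁ tw) i , insertAt i 1 (map suc (proj₂ tw))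

splicings : ℕ → List (Tree × List ℕ)
splicings zero    = (leaf , []) ∷ []
splicings (suc j) = concatMap (λ tw → map (splice tw) (upTo (suc j))) (splicings j)

Splicing : ℕ → Tree × List ℕ → Set
Splicing j (t , w) = Cartesian w t × length w ≡ j × All (1 ≤_) w

splicings-valid : ∀ j → All (Splicing j) (splicings j)
splicings-valid zero    = (empty , refl , []) ∷ []
splicings-valid (suc j) = concat⁺ (map⁺ (All.map extend (splicings-valid j)))
  where
  extend : ∀ {tw} → Splicing j tw → All (Splicing (suc j)) (map (splice tw) (upTo (suc j)))
  extend {t , w} (c , w≡j , 1≤w) = map⁺ (applyUpTo⁺₂ (λ i → i) (suc j) (λ i →
    Cartesian-insertAt 1≤w c i ,
    trans (length-insertAt i 1 (map suc w)) (cong suc (trans (length-map suc w) w≡j)) ,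
    ++⁺ (take⁺ i 1≤sw) (s≤s z≤n ∷ drop⁺ i 1≤sw)))
    where 1≤sw : All (1 ≤_) (map suc w)
          1≤sw = map⁺ (All.universal (λ _ → s≤s z≤n) w)

sgSeqs≡splicings : ∀ j → sgSeqs j ≡ map (λ tw → proj₁ tw , inv (proj₂ tw)) (splicings j)
sgSeqs≡splicings zero    = refl
sgSeqs≡splicings (suc j) = begin
  concatMap step (sgSeqs j)
    ≡⟨ cong (concatMap step) (sgSeqs≡splicings j) ⟩
  concatMap step (map toSgSeq (splicings j))
    ≡⟨ concatMap-map step toSgSeq (splicings j) ⟩
  concatMap (λ tw → step (toSgSeq tw)) (splicings j)
    ≡⟨ cong concat (map-cong-local (All.map step-toSgSeq (splicings-valid j))) ⟩
  concatMap (λ tw → map toSgSeq (map (splice tw) (upTo (suc j)))) (splicings j)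
    ≡⟨ sym (map-concatMap toSgSeq (λ tw → map (splice tw) (upTo (suc j))) (splicings j)) ⟩
  map toSgSeq (splicings (suc j)) ∎
  where
  open ≡-Reasoning
  toSgSeq : Tree × List ℕ → Tree × ℕ
  toSgSeq tw = proj₁ tw , inv (proj₂ tw)
  step : Tree × ℕ → List (Tree × ℕ)
  step ts = map (λ i → SG (proj₁ ts) i , proj₂ ts + i) (upTo (suc j))
  step-toSgSeq : ∀ {tw} → Splicing j tw → step (toSgSeq tw) ≡ map toSgSeq (map (splice tw) (upTo (suc j)))
  step-toSgSeq {t , w} (_ , w≡j , 1≤w) =
    trans (map-cong-local (All.map (λ {i} i<sj → cong (SG t i ,_)
            (sym (inv-insertAt-minimum i w 1≤w (subst (i ≤_) (sym w≡j) (≤-pred i<sj))))) (all-upTo (suc j))))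
          (map-∘ (upTo (suc j)))

-- Arrangements

distinct-∷⁻ : ∀ x R → distinct (x ∷ R) ≡ true → memb x R ≡ false × distinct R ≡ true
distinct-∷⁻ x R d with memb x R
... | false = refl , d

memb-map-suc : ∀ x w → memb (suc x) (map suc w) ≡ memb x w
memb-map-suc x []      = refl
memb-map-suc x (y ∷ w) = cong (if x ≡ᵇ y then true else_) (memb-map-suc x w)

distinct-map-suc : ∀ w → distinct (map suc w) ≡ distinct w
distinct-map-suc []      = refl
distinct-map-suc (x ∷ w) rewrite memb-map-suc x w | distinct-map-suc w = refl

memb-zero-map-suc : ∀ w → memb 0 (map suc w) ≡ false
memb-zero-map-suc []      = refl
memb-zero-map-suc (x ∷ w) = memb-zero-map-suc w

distinct-upTo : ∀ k → distinct (upTo k) ≡ true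
distinct-upTo zero    = refl
distinct-upTo (suc k)
  rewrite sym (map-applyUpTo (λ i → i) suc k) | memb-zero-map-suc (upTo k) | distinct-map-suc (upTo k) =
  distinct-upTo k

remove : ℕ → List ℕ → List ℕ
remove a []      = []
remove a (b ∷ A) = if a ≡ᵇ b then remove a A else b ∷ remove a A

arrangements : ℕ → List ℕ → List (List ℕ)
arrangements zero    A = [] ∷ []
arrangements (suc n) A = concatMap (λ a → map (a ∷_) (arrangements n (remove a A))) A

remove-comm : ∀ a b A → remove a (remove b A) ≡ remove b (remove a A)
remove-comm a b [] = refl
remove-comm a b (c ∷ A) with b ≡ᵇ c in b≡c | a ≡ᵇ c in a≡c
... | true  | true  = remove-comm a b A
... | true  | false rewrite b≡c = remove-comm a b A
... | false | true  rewrite a≡c = remove-comm a b A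
... | false | false rewrite a≡c | b≡c = cong (c ∷_) (remove-comm a b A)

remove-∉ : ∀ a A → memb a A ≡ false → remove a A ≡ A
remove-∉ a []      _ = refl
remove-∉ a (b ∷ A) m with a ≡ᵇ b
... | false = cong (b ∷_) (remove-∉ a A m)

memb-remove⁻ : ∀ x a A → memb x (remove a A) ≡ true → memb x A ≡ true × (a ≡ᵇ x) ≡ false
memb-remove⁻ x a (b ∷ A) m with a ≡ᵇ b in a≡b | x ≡ᵇ b in x≡b
... | true  | true  with ≡ᵇ≡true⇒≡ {x} x≡b
...   | refl = ⊥-elim (true≢false (trans (sym a≡b) (proj₂ (memb-remove⁻ x a A m))))
memb-remove⁻ x a (b ∷ A) m | true  | false = memb-remove⁻ x a A m
memb-remove⁻ x a (b ∷ A) m | false | true with ≡ᵇ≡true⇒≡ {x} x≡b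
...   | refl = refl , a≡b
memb-remove⁻ x a (b ∷ A) m | false | false rewrite x≡b = memb-remove⁻ x a A m

memb-remove⁺ : ∀ x a A → memb x A ≡ true → (a ≡ᵇ x) ≡ false → memb x (remove a A) ≡ true
memb-remove⁺ x a (b ∷ A) m a≢x with a ≡ᵇ b in a≡b | x ≡ᵇ b in x≡b
... | true  | true  with ≡ᵇ≡true⇒≡ {x} x≡b
...   | refl = ⊥-elim (true≢false (trans (sym a≡b) a≢x))
memb-remove⁺ x a (b ∷ A) m a≢x | true  | false = memb-remove⁺ x a A m a≢x
memb-remove⁺ x a (b ∷ A) m a≢x | false | true  rewrite x≡b = refl
memb-remove⁺ x a (b ∷ A) m a≢x | false | false rewrite x≡b = memb-remove⁺ x a A m a≢x

distinct-remove : ∀ a A → distinct A ≡ true → distinct (remove a A) ≡ true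
distinct-remove a []      _ = refl
distinct-remove a (b ∷ A) d with distinct-∷⁻ b A d
... | b∉A , dA with a ≡ᵇ b
... | true  = distinct-remove a A dA
... | false with memb b (remove a A) in b∈
...   | true  = ⊥-elim (true≢false (trans (sym (proj₁ (memb-remove⁻ b a A b∈))) b∉A))
...   | false = distinct-remove a A dA

length-remove : ∀ a A → distinct A ≡ true → memb a A ≡ true → suc (length (remove a A)) ≡ length A
length-remove a (b ∷ A) d a∈ with distinct-∷⁻ b A d
... | b∉A , dA with a ≡ᵇ b in a≡b
... | true with ≡ᵇ≡true⇒≡ {a} a≡b
...   | refl = cong suc (cong length (remove-∉ a A b∉A))
length-remove a (b ∷ A) d a∈ | b∉A , dA | false = cong suc (length-remove a A dA a∈)

remove-map-suc : ∀ a B → remove (suc a) (map suc B) ≡ map suc (remove a B)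
remove-map-suc a []      = refl
remove-map-suc a (b ∷ B) with a ≡ᵇ b
... | true  = remove-map-suc a B
... | false = cong (suc b ∷_) (remove-map-suc a B)

remove-zero-map-suc : ∀ B → remove 0 (map suc B) ≡ map suc B
remove-zero-map-suc []      = refl
remove-zero-map-suc (b ∷ B) = cong (suc b ∷_) (remove-zero-map-suc B)

arrangements-map-suc : ∀ n B → arrangements n (map suc B) ≡ map (map suc) (arrangements n B)
arrangements-map-suc zero    B = refl
arrangements-map-suc (suc n) B = begin
  concatMap (λ a → map (a ∷_) (arrangements n (remove a (map suc B)))) (map suc B)
    ≡⟨ concatMap-map _ suc B ⟩
  concatMap (λ b → map (suc b ∷_) (arrangements n (remove (suc b) (map suc B)))) B
    ≡⟨ cong concat (map-cong-local (All.universal step B)) ⟩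
  concatMap (λ b → map (map suc) (map (b ∷_) (arrangements n (remove b B)))) B
    ≡⟨ sym (map-concatMap (map suc) (λ b → map (b ∷_) (arrangements n (remove b B))) B) ⟩
  map (map suc) (arrangements (suc n) B) ∎
  where
  open ≡-Reasoning
  step : ∀ b → map (suc b ∷_) (arrangements n (remove (suc b) (map suc B)))
             ≡ map (map suc) (map (b ∷_) (arrangements n (remove b B)))
  step b rewrite remove-map-suc b B | arrangements-map-suc n (remove b B) =
    trans (sym (map-∘ (arrangements n (remove b B)))) (map-∘ (arrangements n (remove b B)))

module Sums {c ℓ} (R : CommutativeSemiring c ℓ) where
  open CommutativeSemiring R
    using (Carrier; _≈_; 0#; setoid; reflexive; +-cong; +-congˡ)
    renaming (_+_ to _⊕_; refl to ≈-refl; sym to ≈-sym; trans to ≈-trans;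
              +-identityˡ to ⊕-identityˡ; +-identityʳ to ⊕-identityʳ; +-assoc to ⊕-assoc)
  open import Relation.Binary.Reasoning.Setoid setoid
  open import Algebra.Properties.CommutativeSemigroup (CommutativeSemiring.+-commutativeSemigroup R)
    using (interchange; x∙yz≈y∙xz)

  ∑ : {A : Set} → (A → Carrier) → List A → Carrier
  ∑ f xs = sumR R (map f xs)

  ∑-++ : {A : Set} (f : A → Carrier) (xs ys : List A) → ∑ f (xs ++ ys) ≈ ∑ f xs ⊕ ∑ f ys
  ∑-++ f []       ys = ≈-sym (⊕-identityˡ _)
  ∑-++ f (x ∷ xs) ys = ≈-trans (+-congˡ (∑-++ f xs ys)) (≈-sym (⊕-assoc _ _ _))

  ∑-map : {A B : Set} (f : B → Carrier) (g : A → B) (xs : List A) → ∑ f (map g xs) ≡ ∑ (λ x → f (g x)) xs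
  ∑-map f g xs = ≡.cong (sumR R) (≡.sym (map-∘ xs))

  ∑-cong : {A : Set} {f g : A → Carrier} → (∀ x → f x ≈ g x) → (xs : List A) → ∑ f xs ≈ ∑ g xs
  ∑-cong e []       = ≈-refl
  ∑-cong e (x ∷ xs) = +-cong (e x) (∑-cong e xs)

  ∑-cong-All : {A : Set} {f g : A → Carrier} {xs : List A} → All (λ x → f x ≈ g x) xs → ∑ f xs ≈ ∑ g xs
  ∑-cong-All []           = ≈-refl
  ∑-cong-All (fx≈gx ∷ es) = +-cong fx≈gx (∑-cong-All es)

  ∑-concatMap : {A B : Set} (f : B → Carrier) (g : A → List B) (xs : List A) →
                ∑ f (concatMap g xs) ≈ ∑ (λ x → ∑ f (g x)) xs
  ∑-concatMap f g []       = ≈-refl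
  ∑-concatMap f g (x ∷ xs) = ≈-trans (∑-++ f (g x) (concatMap g xs)) (+-congˡ (∑-concatMap f g xs))

  ∑-concatMap-map : {A B C : Set} (f : C → Carrier) (k : A → B → C) (ys : A → List B) (xs : List A) →
    ∑ f (concatMap (λ x → map (k x) (ys x)) xs) ≈ ∑ (λ x → ∑ (λ y → f (k x y)) (ys x)) xs
  ∑-concatMap-map f k ys xs =
    ≈-trans (∑-concatMap f _ xs) (∑-cong (λ x → reflexive (∑-map f (k x) (ys x))) xs)

  ∑-zero : {A : Set} (xs : List A) → ∑ (λ _ → 0#) xs ≈ 0#
  ∑-zero []       = ≈-refl
  ∑-zero (x ∷ xs) = ≈-trans (⊕-identityˡ _) (∑-zero xs)

  ∑-⊕ : {A : Set} (f g : A → Carrier) (xs : List A) → ∑ (λ x → f x ⊕ g x) xs ≈ ∑ f xs ⊕ ∑ g xs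
  ∑-⊕ f g []       = ≈-sym (⊕-identityˡ _)
  ∑-⊕ f g (x ∷ xs) = ≈-trans (+-congˡ (∑-⊕ f g xs)) (interchange _ _ _ _)

  ∑-swap : {A B : Set} (f : A → B → Carrier) (xs : List A) (ys : List B) →
           ∑ (λ x → ∑ (f x) ys) xs ≈ ∑ (λ y → ∑ (λ x → f x y) xs) ys
  ∑-swap f []       ys = ≈-sym (∑-zero ys)
  ∑-swap f (x ∷ xs) ys = ≈-trans (+-congˡ (∑-swap f xs ys)) (≈-sym (∑-⊕ (f x) (λ y → ∑ (λ x → f x y) xs) ys))

  ∑-cong-memb : {f g : ℕ → Carrier} (A : List ℕ) → (∀ a → memb a A ≡ true → f a ≈ g a) → ∑ f A ≈ ∑ g A
  ∑-cong-memb []      e = ≈-refl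
  ∑-cong-memb (b ∷ A) e = +-cong (e b b∈) (∑-cong-memb A (λ a a∈A → e a (∈-tail a a∈A)))
    where
    b∈ : memb b (b ∷ A) ≡ true
    b∈ rewrite ≡ᵇ-refl b = ≡.refl
    ∈-tail : ∀ a → memb a A ≡ true → memb a (b ∷ A) ≡ true
    ∈-tail a a∈A with a ≡ᵇ b
    ... | true  = ≡.refl
    ... | false = a∈A

  ∑-remove : ∀ a (X : ℕ → Carrier) (A : List ℕ) →
             ∑ (λ b → if a ≡ᵇ b then 0# else X b) A ≈ ∑ X (remove a A)
  ∑-remove a X []      = ≈-refl
  ∑-remove a X (b ∷ A) with a ≡ᵇ b
  ... | true  = ≈-trans (⊕-identityˡ _) (∑-remove a X A)
  ... | false = +-congˡ (∑-remove a X A)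

  ∑-pick : ∀ (X : ℕ → Carrier) m A → distinct A ≡ true → memb m A ≡ true → ∑ X A ≈ X m ⊕ ∑ X (remove m A)
  ∑-pick X m (b ∷ A) d m∈ with distinct-∷⁻ b A d
  ... | b∉A , dA with m ≡ᵇ b in m≡b
  ... | true with ≡ᵇ≡true⇒≡ {m} m≡b
  ...   | ≡.refl = +-congˡ (reflexive (≡.cong (∑ X) (≡.sym (remove-∉ m A b∉A))))
  ∑-pick X m (b ∷ A) d m∈ | b∉A , dA | false = begin
    X b ⊕ ∑ X A                        ≈⟨ +-congˡ (∑-pick X m A dA m∈) ⟩
    X b ⊕ (X m ⊕ ∑ X (remove m A))     ≈⟨ x∙yz≈y∙xz (X b) (X m) _ ⟩
    X m ⊕ (X b ⊕ ∑ X (remove m A))     ∎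

  ∑-allWords-avoiding : ∀ n A a (h : List ℕ → Carrier) →
    ∑ (λ w → if memb a w then 0# else h w) (allWords n A) ≈ ∑ h (allWords n (remove a A))
  ∑-allWords-avoiding zero    A a h = ≈-refl
  ∑-allWords-avoiding (suc n) A a h = begin
    ∑ F (allWords (suc n) A)
      ≈⟨ ∑-concatMap-map F _∷_ (λ _ → allWords n A) A ⟩
    ∑ (λ b → ∑ (λ w → F (b ∷ w)) (allWords n A)) A
      ≈⟨ ∑-cong first-letter A ⟩
    ∑ (λ b → if a ≡ᵇ b then 0# else X b) A
      ≈⟨ ∑-remove a X A ⟩
    ∑ X (remove a A)
      ≈⟨ ≈-sym (∑-concatMap-map h _∷_ (λ _ → allWords n (remove a A)) (remove a A)) ⟩
    ∑ h (allWords (suc n) (remove a A)) ∎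
    where
    F : List ℕ → Carrier
    F w = if memb a w then 0# else h w
    X : ℕ → Carrier
    X b = ∑ (λ w → h (b ∷ w)) (allWords n (remove a A))
    first-letter : ∀ b → ∑ (λ w → F (b ∷ w)) (allWords n A) ≈ (if a ≡ᵇ b then 0# else X b)
    first-letter b with a ≡ᵇ b
    ... | true  = ∑-zero (allWords n A)
    ... | false = ∑-allWords-avoiding n A a (λ w → h (b ∷ w))

  ∑-allWords-distinct : ∀ n A (g : List ℕ → Carrier) →
    ∑ (λ w → if distinct w then g w else 0#) (allWords n A) ≈ ∑ g (arrangements n A)
  ∑-allWords-distinct zero    A g = ≈-refl
  ∑-allWords-distinct (suc n) A g = begin
    ∑ G (allWords (suc n) A)
      ≈⟨ ∑-concatMap-map G _∷_ (λ _ → allWords n A) A ⟩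
    ∑ (λ a → ∑ (λ w → G (a ∷ w)) (allWords n A)) A
      ≈⟨ ∑-cong first-letter A ⟩
    ∑ (λ a → ∑ (λ w → g (a ∷ w)) (arrangements n (remove a A))) A
      ≈⟨ ≈-sym (∑-concatMap-map g _∷_ (λ a → arrangements n (remove a A)) A) ⟩
    ∑ g (arrangements (suc n) A) ∎
    where
    G : List ℕ → Carrier
    G w = if distinct w then g w else 0#
    G′ : ℕ → List ℕ → Carrier
    G′ a w = if distinct w then g (a ∷ w) else 0#
    if-memb : ∀ a w → G (a ∷ w) ≡ (if memb a w then 0# else G′ a w)
    if-memb a w with memb a w
    ... | true  = ≡.refl
    ... | false = ≡.refl
    first-letter : ∀ a → ∑ (λ w → G (a ∷ w)) (allWords n A) ≈ ∑ (λ w → g (a ∷ w)) (arrangements n (remove a A))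
    first-letter a = begin
      ∑ (λ w → G (a ∷ w)) (allWords n A)
        ≈⟨ ∑-cong (λ w → reflexive (if-memb a w)) (allWords n A) ⟩
      ∑ (λ w → if memb a w then 0# else G′ a w) (allWords n A)
        ≈⟨ ∑-allWords-avoiding n A a (G′ a) ⟩
      ∑ (G′ a) (allWords n (remove a A))
        ≈⟨ ∑-allWords-distinct n (remove a A) (λ w → g (a ∷ w)) ⟩
      ∑ (λ w → g (a ∷ w)) (arrangements n (remove a A)) ∎

  ∑-upTo-suc : (H : ℕ → Carrier) (n : ℕ) → ∑ H (upTo (suc n)) ≡ H 0 ⊕ ∑ (λ i → H (suc i)) (upTo n)
  ∑-upTo-suc H n =
    ≡.cong (H 0 ⊕_) (≡.trans (≡.cong (∑ H) (≡.sym (map-applyUpTo (λ i → i) suc n))) (∑-map H suc (upTo n)))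

  ∑-arrangements-insertAt : ∀ n A m → distinct A ≡ true → length A ≡ suc n → memb m A ≡ true →
    ∀ (g : List ℕ → Carrier) →
    ∑ g (arrangements (suc n) A)
    ≈ ∑ (λ i → ∑ (λ v → g (insertAt i m v)) (arrangements n (remove m A))) (upTo (suc n))
  ∑-arrangements-insertAt zero (b ∷ []) m _ _ m∈ g with m ≡ᵇ b in m≡b
  ... | true with ≡ᵇ≡true⇒≡ {m} m≡b
  ...   | ≡.refl = ≈-sym (⊕-identityʳ _)
  ∑-arrangements-insertAt (suc n) A m dA |A| m∈A g = begin
    ∑ g (arrangements (suc (suc n)) A)
      ≈⟨ ∑-concatMap-map g _∷_ (λ a → arrangements (suc n) (remove a A)) A ⟩
    ∑ Z A
      ≈⟨ ∑-pick Z m A dA m∈A ⟩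
    Z m ⊕ ∑ Z (remove m A)
      ≈⟨ +-congˡ (∑-cong-memb (remove m A) insert-m-after-a) ⟩
    Z m ⊕ ∑ (λ a → ∑ (λ i → K i a (remove m (remove a A))) (upTo (suc n))) (remove m A)
      ≈⟨ +-congˡ (∑-swap (λ a i → K i a (remove m (remove a A))) (remove m A) (upTo (suc n))) ⟩
    Z m ⊕ ∑ (λ i → ∑ (λ a → K i a (remove m (remove a A))) (remove m A)) (upTo (suc n))
      ≈⟨ +-congˡ (∑-cong (λ i → ≈-trans
           (∑-cong (λ a → reflexive (≡.cong (K i a) (remove-comm m a A))) (remove m A))
           (≈-sym (∑-concatMap-map (λ w → g (insertAt (suc i) m w)) _∷_
                                   (λ a → arrangements n (remove a (remove m A))) (remove m A))))
           (upTo (suc n))) ⟩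
    Z m ⊕ ∑ (λ i → H (suc i)) (upTo (suc n))
      ≡⟨ ≡.sym (∑-upTo-suc H (suc n)) ⟩
    ∑ H (upTo (suc (suc n))) ∎
    where
    Z : ℕ → Carrier
    Z a = ∑ (λ w → g (a ∷ w)) (arrangements (suc n) (remove a A))
    H : ℕ → Carrier
    H i = ∑ (λ v → g (insertAt i m v)) (arrangements (suc n) (remove m A))
    K : ℕ → ℕ → List ℕ → Carrier
    K i a B = ∑ (λ v → g (a ∷ insertAt i m v)) (arrangements n B)
    insert-m-after-a : ∀ a → memb a (remove m A) ≡ true →
      Z a ≈ ∑ (λ i → K i a (remove m (remove a A))) (upTo (suc n))
    insert-m-after-a a a∈ with memb-remove⁻ a m A a∈
    ... | a∈A , m≢a =
      ∑-arrangements-insertAt n (remove a A) m (distinct-remove a A dA)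
        (suc-injective (≡.trans (length-remove a A dA a∈A) |A|))
        (memb-remove⁺ m a A m∈A (≡.trans (≡ᵇ-sym a m) m≢a)) (λ w → g (a ∷ w))

  ∑-arrangements≈∑-splicings : ∀ j (g : List ℕ → Carrier) →
    ∑ g (arrangements j (map suc (upTo j))) ≈ ∑ (λ tw → g (proj₂ tw)) (splicings j)
  ∑-arrangements≈∑-splicings zero    g = ≈-refl
  ∑-arrangements≈∑-splicings (suc j) g = begin
    ∑ g (arrangements (suc j) A)
      ≈⟨ ∑-arrangements-insertAt j A 1 distinct-A length-A ≡.refl g ⟩
    ∑ (λ i → ∑ (λ v → g (insertAt i 1 v)) (arrangements j (remove 1 A))) (upTo (suc j))
      ≡⟨ ≡.cong (λ B → ∑ (λ i → ∑ (λ v → g (insertAt i 1 v)) (arrangements j B)) (upTo (suc j))) remove-1 ⟩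
    ∑ (λ i → ∑ (λ v → g (insertAt i 1 v)) (arrangements j (map suc U))) (upTo (suc j))
      ≈⟨ ∑-cong (λ i → ≈-trans (reflexive (≡.trans (≡.cong (∑ _) (arrangements-map-suc j U))
                                                     (∑-map _ (map suc) (arrangements j U))))
                               (∑-arrangements≈∑-splicings j (λ u → g (insertAt i 1 (map suc u)))))
                (upTo (suc j)) ⟩
    ∑ (λ i → ∑ (λ tw → g (insertAt i 1 (map suc (proj₂ tw)))) (splicings j)) (upTo (suc j))
      ≈⟨ ∑-swap (λ i tw → g (insertAt i 1 (map suc (proj₂ tw)))) (upTo (suc j)) (splicings j) ⟩
    ∑ (λ tw → ∑ (λ i → g (insertAt i 1 (map suc (proj₂ tw)))) (upTo (suc j))) (splicings j)
      ≈⟨ ≈-sym (∑-concatMap-map (λ tw → g (proj₂ tw)) splice (λ _ → upTo (suc j)) (splicings j)) ⟩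
    ∑ (λ tw → g (proj₂ tw)) (splicings (suc j)) ∎
    where
    A U : List ℕ
    A = map suc (upTo (suc j))
    U = map suc (upTo j)
    distinct-A : distinct A ≡ true
    distinct-A = ≡.trans (distinct-map-suc (upTo (suc j))) (distinct-upTo (suc j))
    length-A : length A ≡ suc j
    length-A = ≡.trans (length-map suc (upTo (suc j))) (length-applyUpTo (λ i → i) (suc j))
    remove-1 : remove 1 A ≡ map suc U
    remove-1 = ≡.trans (remove-map-suc 0 (upTo (suc j)))
                       (≡.cong (map suc) (≡.trans (≡.cong (remove 0) (≡.sym (map-applyUpTo (λ i → i) suc j)))
                                                  (remove-zero-map-suc (upTo j))))

  fTree≈extSum : ∀ q p T → size T ≡ p → fTree R q p T ≈ extSum R q p T
  fTree≈extSum q p T T≡p = begin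
    ∑ F (sgSeqs p)
      ≡⟨ ≡.cong (∑ F) (sgSeqs≡splicings p) ⟩
    ∑ F (map (λ tw → proj₁ tw , inv (proj₂ tw)) (splicings p))
      ≡⟨ ∑-map F (λ tw → proj₁ tw , inv (proj₂ tw)) (splicings p) ⟩
    ∑ (λ tw → F (proj₁ tw , inv (proj₂ tw))) (splicings p)
      ≈⟨ ∑-cong-All (All.map heap-condition (splicings-valid p)) ⟩
    ∑ (λ tw → Ψ (proj₂ tw)) (splicings p)
      ≈⟨ ≈-sym (∑-arrangements≈∑-splicings p Ψ) ⟩
    ∑ Ψ (arrangements p (map suc (upTo p)))
      ≈⟨ ≈-sym (∑-allWords-distinct p (map suc (upTo p)) Ψ) ⟩
    ∑ (λ w → if distinct w then Ψ w else 0#) (labellings p)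
      ≈⟨ ∑-cong (λ w → reflexive (≡.sym (if-∧ (distinct w)))) (labellings p) ⟩
    extSum R q p T ∎
    where
    F : Tree × ℕ → Carrier
    F ts = if eqT (proj₁ ts) T then pow R q (proj₂ ts) else 0#
    Ψ : List ℕ → Carrier
    Ψ w = if heapOrdered T (nth w) then pow R q (inv w) else 0#
    heap-condition : ∀ {tw} → Splicing p tw → F (proj₁ tw , inv (proj₂ tw)) ≈ Ψ (proj₂ tw)
    heap-condition {t , w} (c , w≡p , _) =
      reflexive (≡.cong (λ b → if b then pow R q (inv w) else 0#)
                        (≡.sym (heapOrdered≡eqT T c (≡.trans w≡p (≡.sym T≡p)))))

lemma9 : ∀ {c ℓ} (R : CommutativeSemiring c ℓ) (q : CommutativeSemiring.Carrier R)
           (p : ℕ) (T : Tree) → size T ≡ p →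
           CommutativeSemiring._≈_ R (fTree R q p T) (extSum R q p T) × (fTree' p T ≡ 1)
lemma9 R q p T T≡p = Sums.fTree≈extSum R q p T T≡p , fTree'≡1 p T T≡p
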